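{- Let $(p_n:D_{n+1}\to D_n\mid n\in\omega)$ be a chain of right adjoints in $\mathbf{Po}_A$ (respectively in $\mathbf{Top}_A$). Then the chain has a limit in $\mathbf{Po}_A$ (respectively in $\mathbf{Top}_A$).
   Context: $\mathbf{Po}_A$ is the category of complete lattices and monotonic maps. $\mathbf{Top}_A$ is the category whose objects are $T_0$ topological spaces whose specialization order ($x\le y$ iff every open set containing $x$ contains $y$) is a complete lattice, and whose morphisms are continuous maps; hom-sets are ordered pointwise by the specialization order. A map $g:Y\to X$ in such a category is a right adjoint if there is a morphism $f:X\to Y$ in the same category with $f\circ g\le\mathrm{id}_Y$ and $g\circ f\ge\mathrm{id}_X$ pointwise. -}

module Defs where

open import Level using (Level; _⊔_) renaming (suc to lsuc)
open import Data.Nat using (ℕ; suc)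
open import Data.Product using (Σ; _×_; _,_)
open import Data.Unit.Polymorphic using (⊤)
open import Relation.Unary using (Pred)
open import Relation.Binary.Core using (Rel)
open import Relation.Binary.Bundles using (Poset; Setoid)
open import Relation.Binary.Morphism.Bundles using (PosetHomomorphism)
open import Function.Bundles using (Func)

-- Only the data needed to state the
-- notions of right adjoint and of limit of an ω-chain.

record OrdCat (o h e r : Level) : Set (lsuc (o ⊔ h ⊔ e ⊔ r)) where
  infixr 9 _∘_
  field
    Obj : Set o
    Hom : Obj → Obj → Set h
    _∘_ : ∀ {A B C} → Hom B C → Hom A B → Hom A C
    id  : ∀ {A} → Hom A A
    _≈_ : ∀ {A B} → Rel (Hom A B) e
    _≤_ : ∀ {A B} → Rel (Hom A B) r

module _ {o h e r} (𝒞 : OrdCat o h e r) where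
  open OrdCat 𝒞

  IsRightAdjoint : ∀ {X Y} → Hom Y X → Set (h ⊔ r)
  IsRightAdjoint {X} {Y} g = Σ (Hom X Y) λ f → ((f ∘ g) ≤ id) × (id ≤ (g ∘ f))

  IsCone : (D : ℕ → Obj) (p : ∀ n → Hom (D (suc n)) (D n))
           (X : Obj) (c : ∀ n → Hom X (D n)) → Set e
  IsCone D p X c = ∀ n → (p n ∘ c (suc n)) ≈ c n

  record ChainLimit (D : ℕ → Obj) (p : ∀ n → Hom (D (suc n)) (D n))
         : Set (o ⊔ h ⊔ e) where
    field
      L        : Obj
      π        : ∀ n → Hom L (D n)
      isCone   : IsCone D p L π
      universal : ∀ (X : Obj) (c : ∀ n → Hom X (D n)) → IsCone D p X c →
                  Σ (Hom X L) λ u →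
                    (∀ n → (π n ∘ u) ≈ c n) ×
                    (∀ v → (∀ n → (π n ∘ v) ≈ c n) → v ≈ u)

record CompleteLattice (ℓ : Level) : Set (lsuc ℓ) where
  field
    poset : Poset ℓ ℓ ℓ
  open Poset poset
  field
    ⋁       : Pred Carrier ℓ → Carrier
    ⋁-upper : ∀ (S : Pred Carrier ℓ) x → S x → x ≤ ⋁ S
    ⋁-least : ∀ (S : Pred Carrier ℓ) u → (∀ x → S x → x ≤ u) → ⋁ S ≤ u

PoA : (ℓ : Level) → OrdCat (lsuc ℓ) ℓ ℓ ℓ
PoA ℓ = record
  { Obj = CompleteLattice ℓ
  ; Hom = λ A B → PosetHomomorphism (CompleteLattice.poset A) (CompleteLattice.poset B)
  ; _∘_ = λ {A} {B} {C} g f → record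
      { ⟦_⟧ = λ x → PosetHomomorphism.⟦_⟧ g (PosetHomomorphism.⟦_⟧ f x)
      ; isOrderHomomorphism = record
        { cong = λ eq → PosetHomomorphism.cong g (PosetHomomorphism.cong f eq)
        ; mono = λ le → PosetHomomorphism.mono g (PosetHomomorphism.mono f le) } }
  ; id  = λ {A} → record
      { ⟦_⟧ = λ x → x
      ; isOrderHomomorphism = record { cong = λ eq → eq ; mono = λ le → le } }
  ; _≈_ = λ {A} {B} f g → ∀ x →
      Poset._≈_ (CompleteLattice.poset B) (PosetHomomorphism.⟦_⟧ f x) (PosetHomomorphism.⟦_⟧ g x)
  ; _≤_ = λ {A} {B} f g → ∀ x →
      Poset._≤_ (CompleteLattice.poset B) (PosetHomomorphism.⟦_⟧ f x) (PosetHomomorphism.⟦_⟧ g x)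
  }

record TopSpace (ℓ : Level) : Set (lsuc (lsuc ℓ)) where
  field
    setoid : Setoid ℓ ℓ
  open Setoid setoid
  field
    Open      : Pred (Pred Carrier ℓ) (lsuc ℓ)
    Open-resp : ∀ {U} → Open U → ∀ {x y} → x ≈ y → U x → U y
    Open-ext  : ∀ {U V} → Open U → (∀ x → U x → V x) → (∀ x → V x → U x) → Open V
    Open-univ : Open (λ _ → ⊤)
    Open-∩    : ∀ {U V} → Open U → Open V → Open (λ x → U x × V x)
    Open-⋃    : (I : Set ℓ) (U : I → Pred Carrier ℓ) → (∀ i → Open (U i)) →
                Open (λ x → Σ I λ i → U i x)

Specialization : ∀ {ℓ} (T : TopSpace ℓ) → Rel (Setoid.Carrier (TopSpace.setoid T)) (lsuc ℓ)
Specialization T x y = ∀ U → TopSpace.Open T U → U x → U y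

record TopAObj (ℓ : Level) : Set (lsuc (lsuc ℓ)) where
  field
    space : TopSpace ℓ
  open TopSpace space
  open Setoid setoid
  _⊑_ = Specialization space
  field
    T₀      : ∀ x y → x ⊑ y → y ⊑ x → x ≈ y
    ⋁       : Pred Carrier ℓ → Carrier
    ⋁-upper : ∀ (S : Pred Carrier ℓ) x → S x → x ⊑ ⋁ S
    ⋁-least : ∀ (S : Pred Carrier ℓ) u → (∀ x → S x → x ⊑ u) → ⋁ S ⊑ u

record Continuous {ℓ} (X Y : TopSpace ℓ) : Set (lsuc ℓ) where
  field
    func : Func (TopSpace.setoid X) (TopSpace.setoid Y)
  open Func func public
  field
    continuous : ∀ U → TopSpace.Open Y U → TopSpace.Open X (λ x → U (to x))

TopA : (ℓ : Level) → OrdCat (lsuc (lsuc ℓ)) (lsuc ℓ) ℓ (lsuc ℓ)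
TopA ℓ = record
  { Obj = TopAObj ℓ
  ; Hom = λ A B → Continuous (TopAObj.space A) (TopAObj.space B)
  ; _∘_ = λ g f → record
      { func = record
        { to   = λ x → Continuous.to g (Continuous.to f x)
        ; cong = λ eq → Continuous.cong g (Continuous.cong f eq) }
      ; continuous = λ U o → Continuous.continuous f _ (Continuous.continuous g U o) }
  ; id  = record
      { func = record { to = λ x → x ; cong = λ eq → eq }
      ; continuous = λ U o → o }
  ; _≈_ = λ {A} {B} f g → ∀ x →
      Setoid._≈_ (TopSpace.setoid (TopAObj.space B)) (Continuous.to f x) (Continuous.to g x)
  ; _≤_ = λ {A} {B} f g → ∀ x →
      Specialization (TopAObj.space B) (Continuous.to f x) (Continuous.to g x)
  }

{-# OPTIONS --safe #-}
-- Elements of the limit are threads (xₙ) with pₙ xₙ₊₁ ≈ xₙ.  A right adjoint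
-- preserves meets, so the coordinatewise meet of a family of threads is again
-- a thread; hence the threads form a complete lattice under the coordinatewise
-- order, and the projections are monotone.  In Top_A the same lattice carries
-- the initial topology of the projections, whose specialization order is again
-- coordinatewise, so it is an object of Top_A and the limit there as well.
module Submission where

open import Defs
open import Level using (Level) renaming (suc to lsuc)
open import Data.Nat using (ℕ; zero; suc; _+_; _≤′_; ≤′-refl; ≤′-step)
open import Data.Nat.Properties using (≤⇒≤′; m≤m+n; m≤n+m)
open import Data.Product using (Σ; _×_; _,_; proj₁; proj₂)
open import Data.Sum using (_⊎_; inj₁; inj₂)
open import Data.Unit.Polymorphic using (⊤; tt)
open import Relation.Unary using (Pred)
open import Relation.Binary.Bundles using (Poset; Setoid)
open import Relation.Binary.Morphism.Bundles using (PosetHomomorphism)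
open PosetHomomorphism using (⟦_⟧; mono)

module CompleteLatticeProperties {ℓ : Level} (𝕃 : CompleteLattice ℓ) where
  open CompleteLattice 𝕃 public
  open Poset poset public

  ⋀ : Pred Carrier ℓ → Carrier
  ⋀ T = ⋁ (λ x → ∀ t → T t → x ≤ t)

  ⋀-lower : ∀ T t → T t → ⋀ T ≤ t
  ⋀-lower T t Tt = ⋁-least _ t (λ x x≤T → x≤T t Tt)

  ⋀-greatest : ∀ T y → (∀ t → T t → y ≤ t) → y ≤ ⋀ T
  ⋀-greatest T = ⋁-upper _

module _ {ℓ : Level} {X Y : CompleteLattice ℓ} where
  private
    module X = CompleteLatticeProperties X
    module Y = CompleteLatticeProperties Y

  -- T′ need only be mutually coinitial with the image g[T].
  rightAdjoint-preserves-⋀ :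
    (g : OrdCat.Hom (PoA ℓ) Y X) → IsRightAdjoint (PoA ℓ) {X} {Y} g →
    (T : Pred Y.Carrier ℓ) (T′ : Pred X.Carrier ℓ) →
    (∀ a → T′ a → Σ Y.Carrier λ t → T t × ⟦ g ⟧ t X.≤ a) →
    (∀ t → T t → Σ X.Carrier λ a → T′ a × a X.≤ ⟦ g ⟧ t) →
    ⟦ g ⟧ (Y.⋀ T) X.≈ X.⋀ T′
  rightAdjoint-preserves-⋀ g (f , f∘g≤id , id≤g∘f) T T′ T′≥gT gT≥T′ =
    X.antisym g⋀≤⋀ ⋀≤g⋀
    where
    g⋀≤⋀ : ⟦ g ⟧ (Y.⋀ T) X.≤ X.⋀ T′
    g⋀≤⋀ = X.⋀-greatest T′ _ λ a T′a →
      let (t , Tt , gt≤a) = T′≥gT a T′a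
      in X.trans (mono g (Y.⋀-lower T t Tt)) gt≤a

    f⋀≤⋀ : ⟦ f ⟧ (X.⋀ T′) Y.≤ Y.⋀ T
    f⋀≤⋀ = Y.⋀-greatest T _ λ t Tt →
      let (a , T′a , a≤gt) = gT≥T′ t Tt
      in Y.trans (mono f (X.trans (X.⋀-lower T′ a T′a) a≤gt)) (f∘g≤id t)

    ⋀≤g⋀ : X.⋀ T′ X.≤ ⟦ g ⟧ (Y.⋀ T)
    ⋀≤g⋀ = X.trans (id≤g∘f _) (mono g f⋀≤⋀)

module ThreadLattice {ℓ : Level} (D : ℕ → CompleteLattice ℓ)
  (p : ∀ n → OrdCat.Hom (PoA ℓ) (D (suc n)) (D n))
  (adj : ∀ n → IsRightAdjoint (PoA ℓ) {D n} {D (suc n)} (p n)) where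

  private
    module D n = CompleteLatticeProperties (D n)

  record Thread : Set ℓ where
    constructor thread
    field
      at         : ∀ n → D.Carrier n
      compatible : ∀ n → D._≈_ n (⟦ p n ⟧ (at (suc n))) (at n)
  open Thread public

  _≈ₜ_ _≤ₜ_ : Thread → Thread → Set ℓ
  x ≈ₜ y = ∀ n → D._≈_ n (at x n) (at y n)
  x ≤ₜ y = ∀ n → D._≤_ n (at x n) (at y n)

  threadPoset : Poset ℓ ℓ ℓ
  threadPoset = record
    { Carrier = Thread ; _≈_ = _≈ₜ_ ; _≤_ = _≤ₜ_
    ; isPartialOrder = record
      { isPreorder = record
        { isEquivalence = record
          { refl  = λ n → D.Eq.refl n
          ; sym   = λ x≈y n → D.Eq.sym n (x≈y n)
          ; trans = λ x≈y y≈z n → D.Eq.trans n (x≈y n) (y≈z n) }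
        ; reflexive = λ x≈y n → D.reflexive n (x≈y n)
        ; trans     = λ x≤y y≤z n → D.trans n (x≤y n) (y≤z n) }
      ; antisym = λ x≤y y≤x n → D.antisym n (x≤y n) (y≤x n) } }

  Coordinates : Pred Thread ℓ → ∀ n → Pred (D.Carrier n) ℓ
  Coordinates S n a = Σ Thread λ s → S s × D._≈_ n a (at s n)

  ⋀ₜ : Pred Thread ℓ → Thread
  ⋀ₜ S = thread (λ n → D.⋀ n (Coordinates S n)) λ n →
    rightAdjoint-preserves-⋀ {X = D n} {D (suc n)} (p n) (adj n)
      (Coordinates S (suc n)) (Coordinates S n)
      (λ { a (s , Ss , a≈sₙ) →
             at s (suc n) , (s , Ss , D.Eq.refl (suc n)) ,
             D.reflexive n (D.Eq.trans n (compatible s n) (D.Eq.sym n a≈sₙ)) })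
      (λ { t (s , Ss , t≈sₙ₊₁) →
             at s n , (s , Ss , D.Eq.refl n) ,
             D.reflexive n (D.Eq.sym n (D.Eq.trans n (PosetHomomorphism.cong (p n) t≈sₙ₊₁)
                                                     (compatible s n))) })

  ⋀ₜ-lower : ∀ S s → S s → ⋀ₜ S ≤ₜ s
  ⋀ₜ-lower S s Ss n = D.⋀-lower n _ _ (s , Ss , D.Eq.refl n)

  ⋀ₜ-greatest : ∀ S y → (∀ s → S s → y ≤ₜ s) → y ≤ₜ ⋀ₜ S
  ⋀ₜ-greatest S y y≤S n = D.⋀-greatest n _ _ λ { a (s , Ss , a≈sₙ) →
    D.trans n (y≤S s Ss n) (D.reflexive n (D.Eq.sym n a≈sₙ)) }

  UpperBounds : Pred Thread ℓ → Pred Thread ℓ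
  UpperBounds S u = ∀ s → S s → s ≤ₜ u

  threadLattice : CompleteLattice ℓ
  threadLattice = record
    { poset   = threadPoset
    ; ⋁       = λ S → ⋀ₜ (UpperBounds S)
    ; ⋁-upper = λ S s Ss → ⋀ₜ-greatest _ s λ u u≥S → u≥S s Ss
    ; ⋁-least = λ S u u≥S → ⋀ₜ-lower _ u u≥S }

  poLimit : ChainLimit (PoA ℓ) D p
  poLimit = record
    { L         = threadLattice
    ; π         = π
    ; isCone    = λ n x → compatible x n
    ; universal = λ X c cone →
        mediating X c cone , (λ n x → D.Eq.refl n) , λ v πv≈c x n → πv≈c n x }
    where
    π : ∀ n → OrdCat.Hom (PoA ℓ) threadLattice (D n)
    π n = record { ⟦_⟧ = λ x → at x n
                 ; isOrderHomomorphism = record { cong = λ x≈y → x≈y n ; mono = λ x≤y → x≤y n } }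

    mediating : ∀ X (c : ∀ n → OrdCat.Hom (PoA ℓ) X (D n)) → IsCone (PoA ℓ) D p X c →
                OrdCat.Hom (PoA ℓ) X threadLattice
    mediating X c cone = record
      { ⟦_⟧ = λ x → thread (λ n → ⟦ c n ⟧ x) (λ n → cone n x)
      ; isOrderHomomorphism = record
        { cong = λ x≈y n → PosetHomomorphism.cong (c n) x≈y
        ; mono = λ x≤y n → mono (c n) x≤y } }

module _ {ℓ : Level} (X : TopSpace ℓ) where
  open TopSpace X
  open Setoid setoid

  open-fromNeighbourhoods : (V : Pred Carrier ℓ) →
    (∀ x → V x → Σ (Pred Carrier ℓ) λ U → Open U × U x × (∀ y → U y → V y)) →
    Open V
  open-fromNeighbourhoods V N =
    Open-ext (Open-⋃ (Σ Carrier V) (λ (x , Vx) → proj₁ (N x Vx))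
                     (λ (x , Vx) → proj₁ (proj₂ (N x Vx))))
             (λ { y ((x , Vx) , Ny) → proj₂ (proj₂ (proj₂ (N x Vx))) y Ny })
             (λ y Vy → (y , Vy) , proj₁ (proj₂ (proj₂ (N y Vy))))

module SpecializationLattice {ℓ : Level} (X : TopAObj ℓ) where
  open TopAObj X public
  open TopSpace space public
  open Setoid setoid public

  ⊑-trans : ∀ {x y z} → x ⊑ y → y ⊑ z → x ⊑ z
  ⊑-trans x⊑y y⊑z U U-open Ux = y⊑z U U-open (x⊑y U U-open Ux)

  ≈⇒⊑ : ∀ {x y} → x ≈ y → x ⊑ y
  ≈⇒⊑ x≈y U U-open Ux = Open-resp U-open x≈y Ux

  _∨_ : Carrier → Carrier → Carrier
  x ∨ y = ⋁ (λ z → (z ≈ x) ⊎ (z ≈ y))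

  -- ⊑ lives one universe up, so CompleteLattice ℓ gets the equivalent small
  -- order x ∨ y ≈ y instead.
  _≤_ : Carrier → Carrier → Set ℓ
  x ≤ y = x ∨ y ≈ y

  ⊑⇒≤ : ∀ {x y} → x ⊑ y → x ≤ y
  ⊑⇒≤ {x} {y} x⊑y =
    T₀ _ _ (⋁-least _ y λ { z (inj₁ z≈x) → ⊑-trans (≈⇒⊑ z≈x) x⊑y
                          ; z (inj₂ z≈y) → ≈⇒⊑ z≈y })
           (⋁-upper _ y (inj₂ refl))

  ≤⇒⊑ : ∀ {x y} → x ≤ y → x ⊑ y
  ≤⇒⊑ x≤y = ⊑-trans (⋁-upper _ _ (inj₁ refl)) (≈⇒⊑ x≤y)

  specializationLattice : CompleteLattice ℓ
  specializationLattice = record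
    { poset = record
      { Carrier = Carrier ; _≈_ = _≈_ ; _≤_ = _≤_
      ; isPartialOrder = record
        { isPreorder = record
          { isEquivalence = isEquivalence
          ; reflexive     = λ x≈y → ⊑⇒≤ (≈⇒⊑ x≈y)
          ; trans         = λ x≤y y≤z → ⊑⇒≤ (⊑-trans (≤⇒⊑ x≤y) (≤⇒⊑ y≤z)) }
        ; antisym = λ x≤y y≤x → T₀ _ _ (≤⇒⊑ x≤y) (≤⇒⊑ y≤x) } }
    ; ⋁       = ⋁
    ; ⋁-upper = λ S x Sx → ⊑⇒≤ (⋁-upper S x Sx)
    ; ⋁-least = λ S u u≥S → ⊑⇒≤ (⋁-least S u λ x Sx → ≤⇒⊑ (u≥S x Sx)) }

open SpecializationLattice using (specializationLattice)

module _ {ℓ : Level} {X Y : TopAObj ℓ} where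
  private
    module X = SpecializationLattice X
    module Y = SpecializationLattice Y

  continuous⇒monotone : (g : OrdCat.Hom (TopA ℓ) X Y) →
    ∀ {x y} → x X.⊑ y → Continuous.to g x Y.⊑ Continuous.to g y
  continuous⇒monotone g x⊑y U U-open = x⊑y _ (Continuous.continuous g U U-open)

  monotoneMap : OrdCat.Hom (TopA ℓ) X Y →
    OrdCat.Hom (PoA ℓ) (specializationLattice X) (specializationLattice Y)
  monotoneMap g = record
    { ⟦_⟧ = Continuous.to g
    ; isOrderHomomorphism = record
      { cong = Continuous.cong g
      ; mono = λ x≤y → Y.⊑⇒≤ (continuous⇒monotone g (X.≤⇒⊑ x≤y)) } }

rightAdjoint-monotoneMap : ∀ {ℓ} {X Y : TopAObj ℓ} (g : OrdCat.Hom (TopA ℓ) Y X) →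
  IsRightAdjoint (TopA ℓ) {X} {Y} g →
  IsRightAdjoint (PoA ℓ) {specializationLattice X} {specializationLattice Y}
                   (monotoneMap {X = Y} {X} g)
rightAdjoint-monotoneMap {X = X} {Y} g (f , f∘g⊑id , id⊑g∘f) =
  monotoneMap {X = X} {Y} f ,
  (λ y → SpecializationLattice.⊑⇒≤ Y (f∘g⊑id y)) ,
  (λ x → SpecializationLattice.⊑⇒≤ X (id⊑g∘f x))

module ThreadSpace {ℓ : Level} (D : ℕ → TopAObj ℓ)
  (p : ∀ n → OrdCat.Hom (TopA ℓ) (D (suc n)) (D n))
  (adj : ∀ n → IsRightAdjoint (TopA ℓ) {D n} {D (suc n)} (p n)) where

  module D n = SpecializationLattice (D n)
  open ThreadLattice (λ n → specializationLattice (D n)) (λ n → monotoneMap {X = D (suc n)} {D n} (p n))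
                     (λ n → rightAdjoint-monotoneMap {X = D n} {D (suc n)} (p n) (adj n))

  descend : ∀ {m n} → m ≤′ n → OrdCat.Hom (TopA ℓ) (D n) (D m)
  descend {m} ≤′-refl = OrdCat.id (TopA ℓ) {D m}
  descend {m} (≤′-step {n} m≤′n) = OrdCat._∘_ (TopA ℓ) {D (suc n)} {D n} {D m} (descend m≤′n) (p n)

  descend-at : ∀ {m n} (m≤′n : m ≤′ n) x → D._≈_ m (Continuous.to (descend m≤′n) (at x n)) (at x m)
  descend-at ≤′-refl x = D.refl _
  descend-at {m} (≤′-step {n} m≤′n) x =
    D.trans m (Continuous.cong (descend m≤′n) (compatible x n)) (descend-at m≤′n x)

  BasicNeighbourhood : Pred Thread ℓ → Thread → ℕ → Set (lsuc ℓ)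
  BasicNeighbourhood V x n =
    Σ (Pred (D.Carrier n) ℓ) λ U → D.Open n U × U (at x n) × (∀ y → U (at y n) → V y)

  IsOpen : Pred (Pred Thread ℓ) (lsuc ℓ)
  IsOpen V = ∀ x → V x → Σ ℕ (BasicNeighbourhood V x)

  deepen : ∀ {m n V x} → m ≤′ n → BasicNeighbourhood V x m → BasicNeighbourhood V x n
  deepen {m} {x = x} m≤′n (U , U-open , Uxₘ , U⊆V) =
    (λ a → U (Continuous.to (descend m≤′n) a)) ,
    Continuous.continuous (descend m≤′n) U U-open ,
    D.Open-resp m U-open (D.sym m (descend-at m≤′n x)) Uxₘ ,
    λ y Uy → U⊆V y (D.Open-resp m U-open (descend-at m≤′n y) Uy)

  IsOpen-∩ : ∀ {V W} → IsOpen V → IsOpen W → IsOpen (λ x → V x × W x)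
  IsOpen-∩ {V} {W} V-open W-open x (Vx , Wx) =
    let (m , bV) = V-open x Vx
        (n , bW) = W-open x Wx
        (A , A-open , Ax , A⊆V) = deepen {V = V} {x} (≤⇒≤′ (m≤m+n m n)) bV
        (B , B-open , Bx , B⊆W) = deepen {V = W} {x} (≤⇒≤′ (m≤n+m n m)) bW
    in m + n , (λ a → A a × B a) , D.Open-∩ (m + n) A-open B-open , (Ax , Bx) ,
       λ y (Ay , By) → A⊆V y Ay , B⊆W y By

  threadTopology : TopSpace ℓ
  threadTopology = record
    { setoid    = record { isEquivalence = Poset.isEquivalence threadPoset }
    ; Open      = IsOpen
    ; Open-resp = λ V-open {x} {y} x≈y Vx →
        let (n , U , U-open , Uxₙ , U⊆V) = V-open x Vx
        in U⊆V y (D.Open-resp n U-open (x≈y n) Uxₙ)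
    ; Open-ext  = λ V-open V⊆W W⊆V x Wx →
        let (n , U , U-open , Uxₙ , U⊆V) = V-open x (W⊆V x Wx)
        in n , U , U-open , Uxₙ , λ y Uyₙ → V⊆W y (U⊆V y Uyₙ)
    ; Open-univ = λ x _ → zero , (λ _ → ⊤) , D.Open-univ zero , tt , λ _ _ → tt
    ; Open-∩    = IsOpen-∩
    ; Open-⋃    = λ I V V-open x (i , Vᵢx) →
        let (n , U , U-open , Uxₙ , U⊆Vᵢ) = V-open i x Vᵢx
        in n , U , U-open , Uxₙ , λ y Uyₙ → i , U⊆Vᵢ y Uyₙ }

  preimage-open : ∀ n U → D.Open n U → IsOpen (λ x → U (at x n))
  preimage-open n U U-open x Uxₙ = n , U , U-open , Uxₙ , λ y Uyₙ → Uyₙ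

  _⊑ₜ_ : Thread → Thread → Set (lsuc ℓ)
  _⊑ₜ_ = Specialization threadTopology

  ⊑ₜ⇒⊑ : ∀ {x y} → x ⊑ₜ y → ∀ n → D._⊑_ n (at x n) (at y n)
  ⊑ₜ⇒⊑ x⊑y n U U-open = x⊑y _ (preimage-open n U U-open)

  ⊑⇒⊑ₜ : ∀ {x y} → (∀ n → D._⊑_ n (at x n) (at y n)) → x ⊑ₜ y
  ⊑⇒⊑ₜ {x} {y} x⊑y V V-open Vx =
    let (n , U , U-open , Uxₙ , U⊆V) = V-open x Vx in U⊆V y (x⊑y n U U-open Uxₙ)

  ≤ₜ⇒⊑ₜ : ∀ {x y} → x ≤ₜ y → x ⊑ₜ y
  ≤ₜ⇒⊑ₜ x≤y = ⊑⇒⊑ₜ λ n → D.≤⇒⊑ n (x≤y n)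

  threadSpace : TopAObj ℓ
  threadSpace = record
    { space   = threadTopology
    ; T₀      = λ x y x⊑y y⊑x n → D.T₀ n _ _ (⊑ₜ⇒⊑ x⊑y n) (⊑ₜ⇒⊑ y⊑x n)
    ; ⋁       = CompleteLattice.⋁ threadLattice
    ; ⋁-upper = λ S x Sx → ≤ₜ⇒⊑ₜ {x} (CompleteLattice.⋁-upper threadLattice S x Sx)
    ; ⋁-least = λ S u u≥S → ≤ₜ⇒⊑ₜ {y = u} (CompleteLattice.⋁-least threadLattice S u
                  λ x Sx n → D.⊑⇒≤ n (⊑ₜ⇒⊑ (u≥S x Sx) n)) }

  topLimit : ChainLimit (TopA ℓ) D p
  topLimit = record
    { L         = threadSpace
    ; π         = π
    ; isCone    = λ n x → compatible x n
    ; universal = λ X c cone →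
        mediating X c cone , (λ n x → D.refl n) , λ v πv≈c x n → πv≈c n x }
    where
    π : ∀ n → OrdCat.Hom (TopA ℓ) threadSpace (D n)
    π n = record { func = record { to = λ x → at x n ; cong = λ x≈y → x≈y n }
                 ; continuous = preimage-open n }

    mediating : ∀ X (c : ∀ n → OrdCat.Hom (TopA ℓ) X (D n)) → IsCone (TopA ℓ) D p X c →
                OrdCat.Hom (TopA ℓ) X threadSpace
    mediating X c cone = record
      { func       = record { to = u ; cong = λ x≈y n → Continuous.cong (c n) x≈y }
      ; continuous = λ V V-open →
          open-fromNeighbourhoods (TopAObj.space X) _ λ x Vux →
            let (n , U , U-open , Uuxₙ , U⊆V) = V-open (u x) Vux
            in (λ z → U (Continuous.to (c n) z)) , Continuous.continuous (c n) U U-open ,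
               Uuxₙ , λ z Uuzₙ → U⊆V (u z) Uuzₙ }
      where
      u : Setoid.Carrier (TopSpace.setoid (TopAObj.space X)) → Thread
      u x = thread (λ n → Continuous.to (c n) x) (λ n → cone n x)

theorem2p10 : (ℓ : Level) →
    ((D : ℕ → OrdCat.Obj (PoA ℓ))
     (p : ∀ n → OrdCat.Hom (PoA ℓ) (D (suc n)) (D n)) →
     (∀ n → IsRightAdjoint (PoA ℓ) {D n} {D (suc n)} (p n)) →
     ChainLimit (PoA ℓ) D p)
    ×
    ((D : ℕ → OrdCat.Obj (TopA ℓ))
     (p : ∀ n → OrdCat.Hom (TopA ℓ) (D (suc n)) (D n)) →
     (∀ n → IsRightAdjoint (TopA ℓ) {D n} {D (suc n)} (p n)) →
     ChainLimit (TopA ℓ) D p)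
theorem2p10 ℓ =
  (λ D p adj → ThreadLattice.poLimit D p adj) ,
  (λ D p adj → ThreadSpace.topLimit D p adj)
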